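{- The chromatic symmetric homology $H_1(K_5;\mathbb{Z})$ of the complete graph $K_5$ (in $q$-degree zero) contains $\mathbb{Z}_2$-torsion, i.e. it has an element of additive order $2$.
   Context: Let $G$ be a simple graph with vertex set $[n]$; order its edges $e_{ij}$ ($i<j$) lexicographically by $(i,j)$. For $F\subseteq E(G)$, let $B_1,\dots,B_r$ be the vertex sets of the connected components of $([n],F)$, $\mathfrak{S}_{\beta(F)}=\mathfrak{S}_{B_1}\times\cdots\times\mathfrak{S}_{B_r}$, $a_F=\sum_{\sigma\in\mathfrak{S}_{\beta(F)}}\sigma\in\mathbb{Z}[\mathfrak{S}_n]$, and $\mathcal{M}_F=\mathbb{Z}[\mathfrak{S}_n]a_F$ (isomorphic to the integral permutation module induced from the trivial module of $\mathfrak{S}_{\beta(F)}$). For $e\in F$, $\mathcal{M}_F\subseteq\mathcal{M}_{F\setminus e}$ and $d_{F,e}$ is the inclusion. $C_i=\bigoplus_{|F|=i}\mathcal{M}_F$, $d_i|_{\mathcal{M}_F}=\sum_{e\in F}(-1)^{\#\{e'\in F:e'<e\}}d_{F,e}$, and $H_i(G;\mathbb{Z})=\ker d_i/\operatorname{im}d_{i+1}$. -}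

module Defs where

open import Data.Bool using (Bool; true; false; _∧_; _∨_; if_then_else_)
open import Data.Nat using (ℕ; zero; suc)
open import Data.Fin using (Fin; zero; suc; #_; _≟_)
open import Data.Fin.Subset using (Subset; _∪_; ⁅_⁆; ∣_∣)
open import Data.Fin.Permutation using (Permutation′; _⟨$⟩ʳ_; _∘ₚ_; flip)
open import Data.Integer using (ℤ; +_; -_; _+_; _*_)
open import Data.List using (List; []; _∷_; foldr; map; allFin)
open import Data.Bool.ListAction using (any; all)
open import Data.Vec using (Vec; lookup; []; _∷_)
open import Data.Product using (Σ; _×_; _,_)
open import Relation.Nullary using (¬_)
open import Relation.Nullary.Decidable using (⌊_⌋)
open import Relation.Binary.PropositionalEquality using (_≡_)

sumℤ : List ℤ → ℤ
sumℤ = foldr _+_ (+ 0)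

sgn : ℕ → ℤ
sgn zero    = + 1
sgn (suc k) = - sgn k

countBelow : ∀ {k} → Subset k → Fin k → ℕ
countBelow (b ∷ bs) zero    = 0
countBelow (b ∷ bs) (suc e) = (if b then 1 else 0) Data.Nat.+ countBelow bs e

-- The chromatic symmetric chain complex (q-degree zero) of a simple graph
-- on vertex set Fin n whose m edges are listed (in lexicographic order, as
-- pairs (i , j) with i < j) by the vector es.  Edge subsets F ⊆ E(G) are
-- subsets of Fin m, and the edge order is the order of indices in es.
module ChainComplex {n m : ℕ} (es : Vec (Fin n × Fin n) m) where

  eqB : Fin n → Fin n → Bool
  eqB u v = ⌊ u ≟ v ⌋

  adj : Subset m → Fin n → Fin n → Bool
  adj F w v = any (λ e → lookup F e ∧ endpoints (lookup es e)) (allFin m)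
    where
    endpoints : Fin n × Fin n → Bool
    endpoints (a , b) = (eqB a w ∧ eqB b v) ∨ (eqB a v ∧ eqB b w)

  reach : Subset m → Fin n → ℕ → Fin n → Bool
  reach F u zero    v = eqB u v
  reach F u (suc k) v = reach F u k v ∨ any (λ w → reach F u k w ∧ adj F w v) (allFin n)

  connected : Subset m → Fin n → Fin n → Bool
  connected F u v = reach F u n v

  -- π ∈ 𝔖_{β(F)} = 𝔖_{B₁} × ⋯ × 𝔖_{B_r}
  inYoung : Subset m → Permutation′ n → Bool
  inYoung F π = all (λ j → connected F j (π ⟨$⟩ʳ j)) (allFin n)

  -- a_F = Σ_{σ ∈ 𝔖_{β(F)}} σ, as its coefficient function on 𝔖_n
  a : Subset m → Permutation′ n → ℤ
  a F π = if inYoung F π then + 1 else + 0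

  -- elements of ℤ[𝔖_n] as finite formal sums Σ c σ
  ZG : Set
  ZG = List (ℤ × Permutation′ n)

  -- group-ring product (Σ c σ) · f, returned as a coefficient function:
  -- coefficient of ρ is Σ c · f(σ⁻¹ ρ)
  _⋆_ : ZG → (Permutation′ n → ℤ) → (Permutation′ n → ℤ)
  (L ⋆ f) ρ = sumℤ (map (λ { (c , σ) → c * f (ρ ∘ₚ flip σ) }) L)

  -- A chain assigns to each F an element y_F ∈ ℤ[𝔖_n]; its F-component is
  -- y_F a_F ∈ 𝓜_F.  (Only components with |F| = i matter for C_i.)
  Chain : Set
  Chain = Subset m → ZG

  comp : Chain → Subset m → Permutation′ n → ℤ
  comp x F = x F ⋆ a F

  d : Chain → Subset m → Permutation′ n → ℤ
  d x G ρ = sumℤ (map term (allFin m))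
    where
    term : Fin m → ℤ
    term e = if lookup G e then + 0
             else sgn (countBelow G e) * comp x (G ∪ ⁅ e ⁆) ρ

  H₁HasElementOfOrder2 : Set
  H₁HasElementOfOrder2 =
    Σ Chain λ x →
      (∀ G → ∣ G ∣ ≡ 0 → ∀ ρ → d x G ρ ≡ + 0)
      × ¬ (Σ Chain λ y → ∀ F → ∣ F ∣ ≡ 1 → ∀ ρ → d y F ρ ≡ comp x F ρ)
      × (Σ Chain λ y → ∀ F → ∣ F ∣ ≡ 1 → ∀ ρ → d y F ρ ≡ + 2 * comp x F ρ)

K5edges : Vec (Fin 5 × Fin 5) 10
K5edges =
  (# 0 , # 1) ∷ (# 0 , # 2) ∷ (# 0 , # 3) ∷ (# 0 , # 4) ∷
  (# 1 , # 2) ∷ (# 1 , # 3) ∷ (# 1 , # 4) ∷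
  (# 2 , # 3) ∷ (# 2 , # 4) ∷
  (# 3 , # 4) ∷ []

module Submission where

-- x is an explicit 1-chain and y an explicit 2-chain of K₅; that x is a cycle and that
-- d y = 2x are identities between finitely many integers, decided by evaluating both sides
-- at every permutation.  That x is not a boundary is witnessed by a cocycle modulo 2: the
-- functional adding up the coefficients of a 1-chain at sixty pairs (edge, permutation)
-- takes the value 3 on x, while its composite with d is additive, only sees the components
-- of a 2-chain on two-edge subsets, and is even on every generator, hence on every boundary.

open import Defs

open import Data.Bool using (Bool; true; false; T; _∧_; _∨_; if_then_else_)
open import Data.Bool.ListAction using (all; and)
open import Data.Bool.Properties using (T-∧; T-∨)
import Data.Bool.Properties as Bool
open import Data.Empty using (⊥-elim)
open import Data.Fin using (Fin; zero; suc; _≟_; _<?_; remQuot; quotient; remainder; combine; punchIn; punchOut)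
open import Data.Fin.Patterns using (0F; 1F; 2F; 3F; 4F; 5F; 6F; 7F; 8F; 9F)
open import Data.Fin.Permutation
  using (Permutation′; _⟨$⟩ʳ_; _⟨$⟩ˡ_; _≈_; _∘ₚ_; flip; id; insert; remove; permutation
        ; insert-remove; inverseˡ; inverseʳ)
open import Data.Fin.Properties using (all?; remQuot-combine; suc-injective)
open import Data.Fin.Subset using (Subset; _∪_; ⁅_⁆; ⊥; ∣_∣) renaming (_∈_ to _∈ₛ_; _∉_ to _∉ₛ_)
open import Data.Fin.Subset.Properties
  using (x∈⁅x⁆; x∈⁅y⁆⇒x≡y; x∈p∪q⁺; x∈p∪q⁻; p⊆p∪q; ∪-comm; ∣⁅x⁆∣≡1)
open import Data.Integer using (ℤ; +_; -_; _+_; _*_)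
import Data.Integer as ℤ
open import Data.Integer.Divisibility.Signed using (_∣_; _∣?_; divides; ∣m∣n⇒∣m+n; ∣n⇒∣m*n)
open import Data.Integer.Properties
  using (+-assoc; +-identityˡ; +-identityʳ; *-zeroˡ; *-zeroʳ; *-identityʳ; *-assoc; *-comm; *-distribˡ-+
        ; +-commutativeSemigroup)
open import Algebra.Properties.CommutativeSemigroup +-commutativeSemigroup using (interchange)
open import Data.List using (List; []; _∷_; _++_; map; allFin; concatMap; foldr; filter; cartesianProduct)
open import Data.List.Membership.Propositional using (_∈_; _∉_)
open import Data.List.Membership.Propositional.Properties using (∈-map⁻)
import Data.List.Membership.DecPropositional as DecMembership
open import Data.List.Properties using (map-cong; map-++; map-∘; map-tabulate; ++-identityʳ)
open import Data.List.Relation.Unary.All using (All; []; _∷_)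
import Data.List.Relation.Unary.All as All
open import Data.List.Relation.Unary.All.Properties using (All¬⇒¬Any)
open import Data.List.Relation.Unary.Any using (satisfied; here; there)
open import Data.List.Relation.Unary.Any.Properties using (any⁻)
open import Data.List.Relation.Unary.Unique.Propositional using (Unique; []; _∷_)
import Data.List.Relation.Unary.Unique.DecPropositional as DecUnique
open import Data.Nat using (ℕ; zero; suc; _!)
import Data.Nat.Properties as ℕ
open import Data.Product using (Σ; ∃; _×_; _,_; proj₁; proj₂; map₁)
open import Data.Sum using (inj₁; inj₂; [_,_])
open import Data.Vec using (Vec; lookup; []; _∷_)
import Data.Vec as Vec
open import Data.Vec.Properties using (≡-dec; []=⇒lookup; lookup⇒[]=; lookup-map)
open import Function using (_∘_)
open import Function.Bundles using (Equivalence)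
open import Relation.Binary.PropositionalEquality
  using (_≡_; _≢_; refl; sym; trans; cong; cong₂; subst; module ≡-Reasoning)
open import Relation.Nullary using (¬_; Dec; yes; no; ¬?; _×-dec_; _→-dec_)
open import Relation.Nullary.Decidable using (⌊_⌋; True; T?; toWitness; fromWitness; from-yes; from-no)

sumℤ-++ : ∀ xs ys → sumℤ (xs ++ ys) ≡ sumℤ xs + sumℤ ys
sumℤ-++ []       ys = sym (+-identityˡ (sumℤ ys))
sumℤ-++ (x ∷ xs) ys = trans (cong (_+_ x) (sumℤ-++ xs ys)) (sym (+-assoc x (sumℤ xs) (sumℤ ys)))

module _ {a} {A : Set a} where

  sumℤ-map-cong : ∀ {f g : A → ℤ} → (∀ u → f u ≡ g u) → ∀ xs → sumℤ (map f xs) ≡ sumℤ (map g xs)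
  sumℤ-map-cong f≗g xs = cong sumℤ (map-cong f≗g xs)

  sumℤ-map-zero : ∀ {f : A → ℤ} → (∀ u → f u ≡ + 0) → ∀ xs → sumℤ (map f xs) ≡ + 0
  sumℤ-map-zero f≗0 []       = refl
  sumℤ-map-zero f≗0 (u ∷ xs) = cong₂ _+_ (f≗0 u) (sumℤ-map-zero f≗0 xs)

  sumℤ-map-+ : ∀ (f g : A → ℤ) xs → sumℤ (map (λ u → f u + g u) xs) ≡ sumℤ (map f xs) + sumℤ (map g xs)
  sumℤ-map-+ f g []       = refl
  sumℤ-map-+ f g (u ∷ xs) = trans (cong (_+_ (f u + g u)) (sumℤ-map-+ f g xs)) (interchange (f u) (g u) _ _)

  sumℤ-map-* : ∀ c (f : A → ℤ) xs → sumℤ (map (λ u → c * f u) xs) ≡ c * sumℤ (map f xs)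
  sumℤ-map-* c f []       = sym (*-zeroʳ c)
  sumℤ-map-* c f (u ∷ xs) = trans (cong (_+_ (c * f u)) (sumℤ-map-* c f xs)) (sym (*-distribˡ-+ c (f u) _))

sumℤ-allFin-suc : ∀ {m} (f : Fin (suc m) → ℤ) →
                  sumℤ (map f (allFin (suc m))) ≡ f zero + sumℤ (map (f ∘ suc) (allFin m))
sumℤ-allFin-suc f =
  cong (λ xs → f zero + sumℤ xs) (trans (map-tabulate suc f) (sym (map-tabulate (λ i → i) (f ∘ suc))))

sumℤ-allFin-single : ∀ {m} (f : Fin m → ℤ) i → (∀ j → j ≢ i → f j ≡ + 0) → sumℤ (map f (allFin m)) ≡ f i
sumℤ-allFin-single {suc m} f zero others≡0 = begin
  sumℤ (map f (allFin (suc m)))             ≡⟨ sumℤ-allFin-suc f ⟩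
  f zero + sumℤ (map (f ∘ suc) (allFin m))  ≡⟨ cong (_+_ (f zero)) (sumℤ-map-zero (λ j → others≡0 (suc j) λ ()) (allFin m)) ⟩
  f zero + + 0                              ≡⟨ +-identityʳ (f zero) ⟩
  f zero                                    ∎
  where open ≡-Reasoning
sumℤ-allFin-single {suc m} f (suc i) others≡0 = begin
  sumℤ (map f (allFin (suc m)))             ≡⟨ sumℤ-allFin-suc f ⟩
  f zero + sumℤ (map (f ∘ suc) (allFin m))  ≡⟨ cong₂ _+_ (others≡0 zero λ ()) (sumℤ-allFin-single (f ∘ suc) i others≡0′) ⟩
  + 0 + f (suc i)                           ≡⟨ +-identityˡ (f (suc i)) ⟩
  f (suc i)                                 ∎
  where
  open ≡-Reasoning
  others≡0′ : ∀ j → j ≢ i → f (suc j) ≡ + 0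
  others≡0′ j j≢i = others≡0 (suc j) (j≢i ∘ suc-injective)

_≟ₛ_ : ∀ {m} (F G : Subset m) → Dec (F ≡ G)
_≟ₛ_ = ≡-dec Bool._≟_

pairSubset : ∀ {m} → Fin m × Fin m → Subset m
pairSubset (p , q) = ⁅ p ⁆ ∪ ⁅ q ⁆

lookup-false⇒∉ : ∀ {m} {G : Subset m} {e} → lookup G e ≡ false → e ∉ₛ G
lookup-false⇒∉ e∉G e∈G with trans (sym ([]=⇒lookup e∈G)) e∉G
... | ()

lookup-⁅⁆ : ∀ {m} {p q : Fin m} → q ≢ p → lookup ⁅ p ⁆ q ≡ false
lookup-⁅⁆ {p = p} {q} q≢p with lookup ⁅ p ⁆ q in q∈⁅p⁆
... | true  = ⊥-elim (q≢p (x∈⁅y⁆⇒x≡y p (lookup⇒[]= q ⁅ p ⁆ q∈⁅p⁆)))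
... | false = refl

∣p∣≡0⇒p≡⊥ : ∀ {m} (p : Subset m) → ∣ p ∣ ≡ 0 → p ≡ ⊥
∣p∣≡0⇒p≡⊥ []          _     = refl
∣p∣≡0⇒p≡⊥ (false ∷ p) ∣p∣≡0 = cong (false ∷_) (∣p∣≡0⇒p≡⊥ p ∣p∣≡0)

∣p∣≡1⇒p≡⁅x⁆ : ∀ {m} (p : Subset m) → ∣ p ∣ ≡ 1 → ∃ λ i → p ≡ ⁅ i ⁆
∣p∣≡1⇒p≡⁅x⁆ (true ∷ p)  ∣p∣≡1 = zero , cong (true ∷_) (∣p∣≡0⇒p≡⊥ p (ℕ.suc-injective ∣p∣≡1))
∣p∣≡1⇒p≡⁅x⁆ (false ∷ p) ∣p∣≡1 with ∣p∣≡1⇒p≡⁅x⁆ p ∣p∣≡1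
... | i , p≡⁅i⁆ = suc i , cong (false ∷_) p≡⁅i⁆

unrank : ∀ n → Fin (n !) → Permutation′ n
unrank zero    _ = id
unrank (suc n) k = insert zero (quotient (n !) k) (unrank n (remainder {suc n} (n !) k))

insert-cong : ∀ {n} i j {π ρ : Permutation′ n} → π ≈ ρ → insert i j π ≈ insert i j ρ
insert-cong i j π≈ρ k with i ≟ k
... | yes _  = refl
... | no i≢k = cong (punchIn j) (π≈ρ (punchOut i≢k))

unrank-combine : ∀ {n} j k → unrank (suc n) (combine j k) ≡ insert zero j (unrank n k)
unrank-combine {n} j k = cong₂ (λ j′ k′ → insert zero j′ (unrank n k′)) (cong proj₁ split) (cong proj₂ split)
  where
  split : remQuot {suc n} (n !) (combine j k) ≡ (j , k)
  split = remQuot-combine {suc n} {n !} j k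

unrank-surjective : ∀ {n} (π : Permutation′ n) → ∃ λ k → unrank n k ≈ π
unrank-surjective {zero}  π = zero , λ ()
unrank-surjective {suc n} π with unrank-surjective (remove zero π)
... | k , unrank-k≈π′ = combine (π ⟨$⟩ʳ zero) k , λ i → begin
  unrank (suc n) (combine (π ⟨$⟩ʳ zero) k) ⟨$⟩ʳ i   ≡⟨ cong (_⟨$⟩ʳ i) (unrank-combine (π ⟨$⟩ʳ zero) k) ⟩
  insert zero (π ⟨$⟩ʳ zero) (unrank n k) ⟨$⟩ʳ i     ≡⟨ insert-cong zero (π ⟨$⟩ʳ zero) unrank-k≈π′ i ⟩
  insert zero (π ⟨$⟩ʳ zero) (remove zero π) ⟨$⟩ʳ i  ≡⟨ insert-remove zero π i ⟩
  π ⟨$⟩ʳ i                                          ∎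
  where open ≡-Reasoning

∀-by-unrank : ∀ {n p} (P : Permutation′ n → Set p) → (∀ π ρ → π ≈ ρ → P π → P ρ) →
              (∀ k → P (unrank n k)) → ∀ π → P π
∀-by-unrank {n} P resp P-unrank π with unrank-surjective π
... | k , unrank-k≈π = resp (unrank n k) π unrank-k≈π (P-unrank k)

flip-cong : ∀ {n} (π ρ : Permutation′ n) → π ≈ ρ → flip π ≈ flip ρ
flip-cong π ρ π≈ρ i = begin
  π ⟨$⟩ˡ i                    ≡⟨ sym (inverseˡ ρ) ⟩
  ρ ⟨$⟩ˡ (ρ ⟨$⟩ʳ (π ⟨$⟩ˡ i))  ≡⟨ cong (ρ ⟨$⟩ˡ_) (sym (π≈ρ (π ⟨$⟩ˡ i))) ⟩
  ρ ⟨$⟩ˡ (π ⟨$⟩ʳ (π ⟨$⟩ˡ i))  ≡⟨ cong (ρ ⟨$⟩ˡ_) (inverseʳ π) ⟩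
  ρ ⟨$⟩ˡ i                    ∎
  where open ≡-Reasoning

-- The first i with f i ≡ y, and the junk value y if there is none; fromImages only
-- accepts vectors for which it is a two-sided inverse.
preimage : ∀ {n} → (Fin n → Fin n) → Fin n → Fin n
preimage {n} f y = foldr (λ i r → if ⌊ f i ≟ y ⌋ then i else r) y (allFin n)

inverts? : ∀ {n} (v : Vec (Fin n) n) →
           Dec ((∀ y → lookup v (preimage (lookup v) y) ≡ y) × (∀ i → preimage (lookup v) (lookup v i) ≡ i))
inverts? v = all? (λ y → lookup v (preimage (lookup v) y) ≟ y) ×-dec all? (λ i → preimage (lookup v) (lookup v i) ≟ i)

fromImages : ∀ {n} (v : Vec (Fin n) n) → {True (inverts? v)} → Permutation′ n
fromImages v {v-inverts} =
  permutation (lookup v) (preimage (lookup v)) (proj₁ (toWitness v-inverts)) (proj₂ (toWitness v-inverts))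

T-ext : ∀ {a b} → (T a → T b) → (T b → T a) → a ≡ b
T-ext {false} {false} _   _   = refl
T-ext {false} {true}  _   b⇒a = ⊥-elim (b⇒a _)
T-ext {true}  {false} a⇒b _   = ⊥-elim (a⇒b _)
T-ext {true}  {true}  _   _   = refl

module _ {n : ℕ} where

  EdgeConstant : ∀ {m} {A : Set} → Vec (Fin n × Fin n) m → Subset m → (Fin n → A) → Set
  EdgeConstant es F lb = ∀ e → T (lookup F e) → lb (proj₁ (lookup es e)) ≡ lb (proj₂ (lookup es e))

  recolour : Fin n → Fin n → Fin n → Fin n
  recolour old new c = if ⌊ c ≟ old ⌋ then new else c

  relabel : Fin n × Fin n → Vec (Fin n) n → Vec (Fin n) n
  relabel (u , v) labels = Vec.map (recolour (lookup labels v) (lookup labels u)) labels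

  relabel-joins : ∀ u v labels → lookup (relabel (u , v) labels) u ≡ lookup (relabel (u , v) labels) v
  relabel-joins u v labels
    rewrite lookup-map u (recolour (lookup labels v) (lookup labels u)) labels
          | lookup-map v (recolour (lookup labels v) (lookup labels u)) labels
    with lookup labels u ≟ lookup labels v | lookup labels v ≟ lookup labels v
  ... | yes _ | yes _     = refl
  ... | no  _ | yes _     = refl
  ... | _     | no lv≢lv = ⊥-elim (lv≢lv refl)

  relabel-preserves : ∀ uv labels {w w′} → lookup labels w ≡ lookup labels w′ →
                      lookup (relabel uv labels) w ≡ lookup (relabel uv labels) w′
  relabel-preserves (u , v) labels {w} {w′} same
    rewrite lookup-map w  (recolour (lookup labels v) (lookup labels u)) labels
          | lookup-map w′ (recolour (lookup labels v) (lookup labels u)) labels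
    = cong (recolour (lookup labels v) (lookup labels u)) same

  componentLabels : ∀ {m} → Vec (Fin n × Fin n) m → Subset m → Vec (Fin n) n
  componentLabels []        []          = Vec.allFin n
  componentLabels (uv ∷ es) (true ∷ F)  = relabel uv (componentLabels es F)
  componentLabels (uv ∷ es) (false ∷ F) = componentLabels es F

  componentLabels-edgeConstant : ∀ {m} (es : Vec (Fin n × Fin n) m) F → EdgeConstant es F (lookup (componentLabels es F))
  componentLabels-edgeConstant ((u , v) ∷ es) (true ∷ F)  zero    _   = relabel-joins u v (componentLabels es F)
  componentLabels-edgeConstant (uv ∷ es)      (true ∷ F)  (suc e) F∋e =
    relabel-preserves uv (componentLabels es F) (componentLabels-edgeConstant es F e F∋e)
  componentLabels-edgeConstant (uv ∷ es)      (false ∷ F) (suc e) F∋e = componentLabels-edgeConstant es F e F∋e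

module _ {n m : ℕ} (es : Vec (Fin n × Fin n) m) where
  open ChainComplex es using (eqB; adj; reach; connected)

  module _ {A : Set} {F : Subset m} {lb : Fin n → A} (lb-const : EdgeConstant es F lb) where

    adj⇒≡ : ∀ {w v} → T (adj F w v) → lb w ≡ lb v
    adj⇒≡ {w} {v} adj-wv with satisfied (any⁻ _ (allFin m) adj-wv)
    ... | e , F∋e∧ends with Equivalence.to (T-∧ {lookup F e}) F∋e∧ends
    ... | F∋e , ends = joined (lookup es e) ends (lb-const e F∋e)
      where
      joined : ∀ ab → T ((eqB (proj₁ ab) w ∧ eqB (proj₂ ab) v) ∨ (eqB (proj₁ ab) v ∧ eqB (proj₂ ab) w)) →
               lb (proj₁ ab) ≡ lb (proj₂ ab) → lb w ≡ lb v
      joined (a , b) ends lba≡lbb with Equivalence.to (T-∨ {eqB a w ∧ eqB b v}) ends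
      ... | inj₁ a≡w∧b≡v with Equivalence.to (T-∧ {eqB a w}) a≡w∧b≡v
      ...   | a≡w , b≡v rewrite toWitness a≡w | toWitness b≡v = lba≡lbb
      joined (a , b) ends lba≡lbb | inj₂ a≡v∧b≡w with Equivalence.to (T-∧ {eqB a v}) a≡v∧b≡w
      ...   | a≡v , b≡w rewrite toWitness a≡v | toWitness b≡w = sym lba≡lbb

    reach⇒≡ : ∀ {u} k {v} → T (reach F u k v) → lb u ≡ lb v
    reach⇒≡ zero u≡v = cong lb (toWitness u≡v)
    reach⇒≡ {u} (suc k) {v} r with Equivalence.to (T-∨ {reach F u k v}) r
    ... | inj₁ reach-k = reach⇒≡ k reach-k
    ... | inj₂ via-w with satisfied (any⁻ _ (allFin n) via-w)
    ...   | w , reach-w∧adj with Equivalence.to (T-∧ {reach F u k w}) reach-w∧adj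
    ...     | reach-w , adj-wv = trans (reach⇒≡ k reach-w) (adj⇒≡ adj-wv)

    connected⇒≡ : ∀ {u v} → T (connected F u v) → lb u ≡ lb v
    connected⇒≡ = reach⇒≡ n

  -- Stated with a partial application so that, when evaluated, the label vector of F is
  -- computed once and shared by all uses of sameLabel F.
  sameLabel : Subset m → Fin n → Fin n → Bool
  sameLabel F = sameEntry (componentLabels es F)
    where
    sameEntry : Vec (Fin n) n → Fin n → Fin n → Bool
    sameEntry labels u v = ⌊ lookup labels u ≟ lookup labels v ⌋

  connected≡sameLabel : ∀ F → (∀ u v → T (sameLabel F u v) → T (connected F u v)) →
                        ∀ u v → connected F u v ≡ sameLabel F u v
  connected≡sameLabel F complete u v =
    T-ext (fromWitness ∘ connected⇒≡ (componentLabels-edgeConstant es F)) (complete u v)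

module Chains {n m : ℕ} (es : Vec (Fin n × Fin n) m) where
  open ChainComplex es using (ZG; Chain; _⋆_)
  open DecMembership (_≟ₛ_ {m}) using (_∈?_)

  ∅ : Chain
  ∅ _ = []

  infixl 6 _⊕_
  _⊕_ : Chain → Chain → Chain
  (x ⊕ y) F = x F ++ y F

  infixr 7 _•_
  _•_ : ℤ → Chain → Chain
  (c • x) F = map (map₁ (c *_)) (x F)

  single : Subset m → ZG → Chain
  single K terms F = if ⌊ F ≟ₛ K ⌋ then terms else []

  generator : Subset m → Permutation′ n → Chain
  generator K σ = single K ((+ 1 , σ) ∷ [])

  restrict : List (Subset m) → Chain → Chain
  restrict ℓ x F = if ⌊ F ∈? ℓ ⌋ then x F else []

  chainOf : List (Subset m × ZG) → Chain
  chainOf L F = concatMap (λ { (K , terms) → single K terms F }) L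

  pairChain : List ((Fin m × Fin m) × ZG) → Chain
  pairChain L = chainOf (map (map₁ pairSubset) L)

  single-≡ : ∀ K terms → single K terms K ≡ terms
  single-≡ K terms with K ≟ₛ K
  ... | yes _  = refl
  ... | no K≢K = ⊥-elim (K≢K refl)

  single-≢ : ∀ {K F} terms → F ≢ K → single K terms F ≡ []
  single-≢ {K} {F} terms F≢K with F ≟ₛ K
  ... | yes F≡K = ⊥-elim (F≢K F≡K)
  ... | no _    = refl

  single-[] : ∀ K F → single K [] F ≡ ∅ F
  single-[] K F with F ≟ₛ K
  ... | yes _ = refl
  ... | no _  = refl

  single-∷ : ∀ K t terms F → single K (t ∷ terms) F ≡ (single K (t ∷ []) ⊕ single K terms) F
  single-∷ K t terms F with F ≟ₛ K
  ... | yes _ = refl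
  ... | no _  = refl

  single-• : ∀ K c σ F → single K ((c , σ) ∷ []) F ≡ (c • generator K σ) F
  single-• K c σ F with F ≟ₛ K
  ... | yes _ = cong (λ c′ → (c′ , σ) ∷ []) (sym (*-identityʳ c))
  ... | no _  = refl

  restrict-∈ : ∀ {ℓ} x {F} → F ∈ ℓ → restrict ℓ x F ≡ x F
  restrict-∈ {ℓ} x {F} F∈ℓ with F ∈? ℓ
  ... | yes _   = refl
  ... | no F∉ℓ = ⊥-elim (F∉ℓ F∈ℓ)

  restrict-∷ : ∀ {K ℓ} x → K ∉ ℓ → ∀ F → restrict (K ∷ ℓ) x F ≡ (single K (x K) ⊕ restrict ℓ x) F
  restrict-∷ {K} {ℓ} x K∉ℓ F with F ≟ₛ K | F ∈? ℓ
  ... | yes refl | yes F∈ℓ = ⊥-elim (K∉ℓ F∈ℓ)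
  ... | yes refl | no _    = sym (++-identityʳ (x F))
  ... | no _     | yes _   = refl
  ... | no _     | no _    = refl

  ⋆-++ : ∀ L L′ f ρ → ((L ++ L′) ⋆ f) ρ ≡ (L ⋆ f) ρ + (L′ ⋆ f) ρ
  ⋆-++ L L′ f ρ = trans (cong sumℤ (map-++ _ L L′)) (sumℤ-++ (map _ L) (map _ L′))

  ⋆-scale : ∀ c L f ρ → (map (map₁ (c *_)) L ⋆ f) ρ ≡ c * (L ⋆ f) ρ
  ⋆-scale c L f ρ = begin
    sumℤ (map term (map (map₁ (c *_)) L))  ≡⟨ cong sumℤ (sym (map-∘ L)) ⟩
    sumℤ (map (term ∘ map₁ (c *_)) L)      ≡⟨ sumℤ-map-cong (λ { (c′ , σ) → *-assoc c c′ _ }) L ⟩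
    sumℤ (map (λ t → c * term t) L)        ≡⟨ sumℤ-map-* c term L ⟩
    c * sumℤ (map term L)                  ∎
    where
    open ≡-Reasoning
    term : ℤ × Permutation′ n → ℤ
    term (c′ , σ) = c′ * f (ρ ∘ₚ flip σ)

youngIndicator : ∀ {n} → (Fin n → Fin n → Bool) → Permutation′ n → ℤ
youngIndicator {n} sameBlock π = if all (λ j → sameBlock j (π ⟨$⟩ʳ j)) (allFin n) then + 1 else + 0

sumOver : ∀ {n m} → List (Fin m × Permutation′ n) → (Subset m → Permutation′ n → ℤ) → ℤ
sumOver P f = sumℤ (map (λ { (i , ρ) → f ⁅ i ⁆ ρ }) P)

sumOver-cong : ∀ {n m} P (f g : Subset m → Permutation′ n → ℤ) → (∀ i ρ → f ⁅ i ⁆ ρ ≡ g ⁅ i ⁆ ρ) →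
               sumOver P f ≡ sumOver P g
sumOver-cong P f g f≡g = sumℤ-map-cong (λ { (i , ρ) → f≡g i ρ }) P

-- The definitions of ChainComplex es with `connected` replaced by `sameBlock`; for
-- sameBlock = connected they unfold to those of ChainComplex es.
module Boundary {n m : ℕ} (es : Vec (Fin n × Fin n) m) (sameBlock : Subset m → Fin n → Fin n → Bool) where
  open ChainComplex es using (ZG; Chain; _⋆_)
  open Chains es

  a : Subset m → Permutation′ n → ℤ
  a F = youngIndicator (sameBlock F)

  comp : Chain → Subset m → Permutation′ n → ℤ
  comp x F = x F ⋆ a F

  face : Subset m → Fin m → ℤ → ℤ
  face G e z = if lookup G e then + 0 else sgn (countBelow G e) * z

  d : Chain → Subset m → Permutation′ n → ℤ
  d x G ρ = sumℤ (map (λ e → face G e (comp x (G ∪ ⁅ e ⁆) ρ)) (allFin m))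

  face-+ : ∀ G e z w → face G e (z + w) ≡ face G e z + face G e w
  face-+ G e z w with lookup G e
  ... | true  = refl
  ... | false = *-distribˡ-+ (sgn (countBelow G e)) z w

  face-* : ∀ G e c z → face G e (c * z) ≡ c * face G e z
  face-* G e c z with lookup G e
  ... | true  = sym (*-zeroʳ c)
  ... | false = trans (sym (*-assoc s c z)) (trans (cong (_* z) (*-comm s c)) (*-assoc c s z))
    where
    s : ℤ
    s = sgn (countBelow G e)

  face-0 : ∀ G e → face G e (+ 0) ≡ + 0
  face-0 G e with lookup G e
  ... | true  = refl
  ... | false = *-zeroʳ (sgn (countBelow G e))

  d-local : ∀ {x y} G ρ → (∀ e → lookup G e ≡ false → x (G ∪ ⁅ e ⁆) ≡ y (G ∪ ⁅ e ⁆)) → d x G ρ ≡ d y G ρ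
  d-local {x} {y} G ρ x≡y = sumℤ-map-cong same (allFin m)
    where
    same : ∀ e → face G e (comp x (G ∪ ⁅ e ⁆) ρ) ≡ face G e (comp y (G ∪ ⁅ e ⁆) ρ)
    same e with lookup G e in e∉G
    ... | true  = refl
    ... | false = cong (λ terms → sgn (countBelow G e) * (terms ⋆ a (G ∪ ⁅ e ⁆)) ρ) (x≡y e e∉G)

  d-∅ : ∀ G ρ → d ∅ G ρ ≡ + 0
  d-∅ G ρ = sumℤ-map-zero (face-0 G) (allFin m)

  d-⊕ : ∀ x y G ρ → d (x ⊕ y) G ρ ≡ d x G ρ + d y G ρ
  d-⊕ x y G ρ = trans (sumℤ-map-cong split (allFin m)) (sumℤ-map-+ _ _ (allFin m))
    where
    split : ∀ e → face G e (comp (x ⊕ y) (G ∪ ⁅ e ⁆) ρ)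
                  ≡ face G e (comp x (G ∪ ⁅ e ⁆) ρ) + face G e (comp y (G ∪ ⁅ e ⁆) ρ)
    split e = trans (cong (face G e) (⋆-++ (x (G ∪ ⁅ e ⁆)) (y (G ∪ ⁅ e ⁆)) (a (G ∪ ⁅ e ⁆)) ρ)) (face-+ G e _ _)

  d-• : ∀ c x G ρ → d (c • x) G ρ ≡ c * d x G ρ
  d-• c x G ρ = trans (sumℤ-map-cong scale (allFin m)) (sumℤ-map-* c _ (allFin m))
    where
    scale : ∀ e → face G e (comp (c • x) (G ∪ ⁅ e ⁆) ρ) ≡ c * face G e (comp x (G ∪ ⁅ e ⁆) ρ)
    scale e = trans (cong (face G e) (⋆-scale c (x (G ∪ ⁅ e ⁆)) (a (G ∪ ⁅ e ⁆)) ρ)) (face-* G e c _)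

  a-≈ : ∀ F {π π′} → π ≈ π′ → a F π ≡ a F π′
  a-≈ F π≈π′ =
    cong (λ b → if b then + 1 else + 0) (cong and (map-cong (λ j → cong (sameBlock F j) (π≈π′ j)) (allFin n)))

  term-≈ : ∀ F ρ ρ′ σ σ′ → ρ ≈ ρ′ → σ ≈ σ′ → a F (ρ ∘ₚ flip σ) ≡ a F (ρ′ ∘ₚ flip σ′)
  term-≈ F ρ ρ′ σ σ′ ρ≈ρ′ σ≈σ′ =
    a-≈ F {ρ ∘ₚ flip σ} {ρ′ ∘ₚ flip σ′} λ j →
      trans (cong (σ ⟨$⟩ˡ_) (ρ≈ρ′ j)) (flip-cong σ σ′ σ≈σ′ (ρ′ ⟨$⟩ʳ j))

  comp-≈ : ∀ x F ρ ρ′ → ρ ≈ ρ′ → comp x F ρ ≡ comp x F ρ′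
  comp-≈ x F ρ ρ′ ρ≈ρ′ =
    sumℤ-map-cong (λ { (c , σ) → cong (c *_) (term-≈ F ρ ρ′ σ σ ρ≈ρ′ λ _ → refl) }) (x F)

  d-≈ : ∀ x G ρ ρ′ → ρ ≈ ρ′ → d x G ρ ≡ d x G ρ′
  d-≈ x G ρ ρ′ ρ≈ρ′ = sumℤ-map-cong (λ e → cong (face G e) (comp-≈ x (G ∪ ⁅ e ⁆) ρ ρ′ ρ≈ρ′)) (allFin m)

  faces-distinct : ∀ {G : Subset m} {e e′} → lookup G e′ ≡ false → e′ ≢ e → G ∪ ⁅ e′ ⁆ ≢ G ∪ ⁅ e ⁆
  faces-distinct {G} {e} {e′} e′∉G e′≢e faces≡
    with x∈p∪q⁻ G ⁅ e ⁆ (subst (e′ ∈ₛ_) faces≡ (x∈p∪q⁺ (inj₂ (x∈⁅x⁆ e′))))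
  ... | inj₁ e′∈G   = lookup-false⇒∉ e′∉G e′∈G
  ... | inj₂ e′∈⁅e⁆ = e′≢e (x∈⁅y⁆⇒x≡y e e′∈⁅e⁆)

  d-single-face : ∀ {G : Subset m} {e} terms ρ → lookup G e ≡ false →
                  d (single (G ∪ ⁅ e ⁆) terms) G ρ ≡ face G e ((terms ⋆ a (G ∪ ⁅ e ⁆)) ρ)
  d-single-face {G} {e} terms ρ e∉G = begin
    d (single K terms) G ρ                ≡⟨ sumℤ-allFin-single _ e other-faces-vanish ⟩
    face G e (comp (single K terms) K ρ)  ≡⟨ cong (λ terms′ → face G e ((terms′ ⋆ a K) ρ)) (single-≡ K terms) ⟩
    face G e ((terms ⋆ a K) ρ)            ∎
    where
    open ≡-Reasoning
    K : Subset m
    K = G ∪ ⁅ e ⁆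
    other-faces-vanish : ∀ e′ → e′ ≢ e → face G e′ (comp (single K terms) (G ∪ ⁅ e′ ⁆) ρ) ≡ + 0
    other-faces-vanish e′ e′≢e with lookup G e′ in e′∉G
    ... | true  = refl
    ... | false = trans (cong (λ terms′ → sgn (countBelow G e′) * (terms′ ⋆ a (G ∪ ⁅ e′ ⁆)) ρ)
                              (single-≢ terms (faces-distinct {G} e′∉G e′≢e)))
                        (*-zeroʳ (sgn (countBelow G e′)))

  d-single-nonface : ∀ {G K : Subset m} {g} terms ρ → g ∈ₛ G → g ∉ₛ K → d (single K terms) G ρ ≡ + 0
  d-single-nonface {G} {K} {g} terms ρ g∈G g∉K = sumℤ-map-zero vanish (allFin m)
    where
    vanish : ∀ e → face G e (comp (single K terms) (G ∪ ⁅ e ⁆) ρ) ≡ + 0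
    vanish e = trans (cong (λ terms′ → face G e ((terms′ ⋆ a (G ∪ ⁅ e ⁆)) ρ))
                           (single-≢ terms λ face≡K → g∉K (subst (g ∈ₛ_) face≡K (p⊆p∪q ⁅ e ⁆ g∈G))))
                     (face-0 G e)

  pairFace : Fin m × Fin m → Fin m → ℤ → ℤ
  pairFace (p , q) i z = if ⌊ i ≟ p ⌋ then face ⁅ p ⁆ q z else if ⌊ i ≟ q ⌋ then face ⁅ q ⁆ p z else + 0

  d-single-pair : ∀ {pq} → proj₁ pq ≢ proj₂ pq → ∀ terms i ρ →
                  d (single (pairSubset pq) terms) ⁅ i ⁆ ρ ≡ pairFace pq i ((terms ⋆ a (pairSubset pq)) ρ)
  d-single-pair {p , q} p≢q terms i ρ with i ≟ p | i ≟ q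
  ... | yes refl | _        = d-single-face {⁅ p ⁆} {q} terms ρ (lookup-⁅⁆ (p≢q ∘ sym))
  ... | no _     | yes refl rewrite ∪-comm ⁅ p ⁆ ⁅ i ⁆ = d-single-face {⁅ i ⁆} {p} terms ρ (lookup-⁅⁆ p≢q)
  ... | no i≢p   | no i≢q   = d-single-nonface {⁅ i ⁆} {⁅ p ⁆ ∪ ⁅ q ⁆} terms ρ (x∈⁅x⁆ i) λ i∈K →
    [ i≢p ∘ x∈⁅y⁆⇒x≡y p , i≢q ∘ x∈⁅y⁆⇒x≡y q ] (x∈p∪q⁻ ⁅ p ⁆ ⁅ q ⁆ i∈K)

  pairChainBoundary : List ((Fin m × Fin m) × ZG) → Fin m → Permutation′ n → ℤ
  pairChainBoundary L i ρ = sumℤ (map (λ { (pq , terms) → pairFace pq i ((terms ⋆ a (pairSubset pq)) ρ) }) L)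

  d-pairChain : ∀ L → All (λ { ((p , q) , _) → p ≢ q }) L → ∀ i ρ →
                d (pairChain L) ⁅ i ⁆ ρ ≡ pairChainBoundary L i ρ
  d-pairChain []                  []                 i ρ = d-∅ ⁅ i ⁆ ρ
  d-pairChain ((pq , terms) ∷ L) (p≢q ∷ L-distinct) i ρ =
    trans (d-⊕ (single (pairSubset pq) terms) (pairChain L) ⁅ i ⁆ ρ)
          (cong₂ _+_ (d-single-pair {pq} p≢q terms i ρ) (d-pairChain L L-distinct i ρ))

  generatorSum : List (Fin m × Permutation′ n) → Fin m × Fin m → Permutation′ n → ℤ
  generatorSum P pq σ = sumℤ (map (λ { (i , ρ) → pairFace pq i ((((+ 1 , σ) ∷ []) ⋆ a (pairSubset pq)) ρ) }) P)

  sumOver-generator : ∀ P {pq} → proj₁ pq ≢ proj₂ pq → ∀ σ → sumOver P (d (generator (pairSubset pq) σ)) ≡ generatorSum P pq σ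
  sumOver-generator P {pq} p≢q σ = sumℤ-map-cong (λ { (i , ρ) → d-single-pair {pq} p≢q _ i ρ }) P

  generatorSum-≈ : ∀ P pq σ σ′ → σ ≈ σ′ → generatorSum P pq σ ≡ generatorSum P pq σ′
  generatorSum-≈ P pq σ σ′ σ≈σ′ = sumℤ-map-cong
    (λ { (i , ρ) → cong (λ z → pairFace pq i (+ 1 * z + + 0))
                        (term-≈ (pairSubset pq) ρ ρ σ σ′ (λ _ → refl) σ≈σ′) }) P

  sumOver-d-cong : ∀ P {x y} → (∀ F → x F ≡ y F) → sumOver P (d x) ≡ sumOver P (d y)
  sumOver-d-cong P {x} {y} x≡y =
    sumOver-cong P (d x) (d y) λ i ρ → d-local {x} {y} ⁅ i ⁆ ρ λ e _ → x≡y (⁅ i ⁆ ∪ ⁅ e ⁆)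

  sumOver-d-∅ : ∀ P → sumOver P (d ∅) ≡ + 0
  sumOver-d-∅ P = sumℤ-map-zero (λ { (i , ρ) → d-∅ ⁅ i ⁆ ρ }) P

  sumOver-d-⊕ : ∀ P x y → sumOver P (d (x ⊕ y)) ≡ sumOver P (d x) + sumOver P (d y)
  sumOver-d-⊕ P x y = trans (sumℤ-map-cong (λ { (i , ρ) → d-⊕ x y ⁅ i ⁆ ρ }) P) (sumℤ-map-+ _ _ P)

  sumOver-d-• : ∀ P c x → sumOver P (d (c • x)) ≡ c * sumOver P (d x)
  sumOver-d-• P c x = trans (sumℤ-map-cong (λ { (i , ρ) → d-• c x ⁅ i ⁆ ρ }) P) (sumℤ-map-* c _ P)

  -- By locality x may be replaced by restrict ℓ x, the sum of the generators single K (x K), K ∈ ℓ.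
  boundaries-divisible : ∀ k P (ℓ : List (Subset m)) → Unique ℓ →
                         (∀ i e → lookup ⁅ i ⁆ e ≡ false → ⁅ i ⁆ ∪ ⁅ e ⁆ ∈ ℓ) →
                         (∀ {K} → K ∈ ℓ → ∀ σ → k ∣ sumOver P (d (generator K σ))) →
                         ∀ x → k ∣ sumOver P (d x)
  boundaries-divisible k P ℓ ℓ-unique faces∈ℓ generator-divisible x =
    subst (k ∣_) (sym restricted) (restrictions-divisible ℓ ℓ-unique (λ K∈ℓ → K∈ℓ))
    where
    k∣0 : k ∣ + 0
    k∣0 = divides (+ 0) (sym (*-zeroˡ k))

    restricted : sumOver P (d x) ≡ sumOver P (d (restrict ℓ x))
    restricted = sumOver-cong P (d x) (d (restrict ℓ x)) λ i ρ →
      d-local {x} {restrict ℓ x} ⁅ i ⁆ ρ λ e e∉⁅i⁆ → sym (restrict-∈ x (faces∈ℓ i e e∉⁅i⁆))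

    generators-divisible : ∀ {K} → K ∈ ℓ → ∀ terms → k ∣ sumOver P (d (single K terms))
    generators-divisible {K} K∈ℓ [] =
      subst (k ∣_) (sym (trans (sumOver-d-cong P (single-[] K)) (sumOver-d-∅ P))) k∣0
    generators-divisible {K} K∈ℓ ((c , σ) ∷ terms) = subst (k ∣_) (sym split)
      (∣m∣n⇒∣m+n (subst (k ∣_) (sym scaled) (∣n⇒∣m*n c (generator-divisible K∈ℓ σ))) (generators-divisible K∈ℓ terms))
      where
      split : sumOver P (d (single K ((c , σ) ∷ terms))) ≡ sumOver P (d (single K ((c , σ) ∷ []))) + sumOver P (d (single K terms))
      split = trans (sumOver-d-cong P (single-∷ K (c , σ) terms)) (sumOver-d-⊕ P (single K ((c , σ) ∷ [])) (single K terms))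
      scaled : sumOver P (d (single K ((c , σ) ∷ []))) ≡ c * sumOver P (d (generator K σ))
      scaled = trans (sumOver-d-cong P (single-• K c σ)) (sumOver-d-• P c (generator K σ))

    restrictions-divisible : ∀ ℓ′ → Unique ℓ′ → (∀ {K} → K ∈ ℓ′ → K ∈ ℓ) → k ∣ sumOver P (d (restrict ℓ′ x))
    restrictions-divisible []       _                  _    = subst (k ∣_) (sym (sumOver-d-∅ P)) k∣0
    restrictions-divisible (K ∷ ℓ′) (K∉ℓ′ ∷ ℓ′-unique) ℓ′⊆ℓ = subst (k ∣_) (sym split)
      (∣m∣n⇒∣m+n (generators-divisible (ℓ′⊆ℓ (here refl)) (x K)) (restrictions-divisible ℓ′ ℓ′-unique (ℓ′⊆ℓ ∘ there)))
      where
      split : sumOver P (d (restrict (K ∷ ℓ′) x)) ≡ sumOver P (d (single K (x K))) + sumOver P (d (restrict ℓ′ x))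
      split = trans (sumOver-d-cong P (restrict-∷ x (All¬⇒¬Any K∉ℓ′))) (sumOver-d-⊕ P (single K (x K)) (restrict ℓ′ x))

module _ {n m : ℕ} (es : Vec (Fin n × Fin n) m) {B : Subset m → Fin n → Fin n → Bool} where
  open ChainComplex es using (connected; a; comp; d)
  private module B = Boundary es B

  comp-via-blocks : ∀ F → (∀ u v → connected F u v ≡ B F u v) → ∀ x ρ → comp x F ρ ≡ B.comp x F ρ
  comp-via-blocks F connected≡B x ρ = sumℤ-map-cong (λ { (c , σ) → cong (c *_) (a≡ (ρ ∘ₚ flip σ)) }) (x F)
    where
    a≡ : ∀ π → a F π ≡ B.a F π
    a≡ π = cong (λ b → if b then + 1 else + 0) (cong and (map-cong (λ j → connected≡B j (π ⟨$⟩ʳ j)) (allFin n)))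

  d-via-blocks : ∀ G → (∀ e → lookup G e ≡ false → ∀ u v → connected (G ∪ ⁅ e ⁆) u v ≡ B (G ∪ ⁅ e ⁆) u v) → ∀ x ρ →
                 d x G ρ ≡ B.d x G ρ
  d-via-blocks G connected≡B x ρ = sumℤ-map-cong same (allFin m)
    where
    same : ∀ e → B.face G e (comp x (G ∪ ⁅ e ⁆) ρ) ≡ B.face G e (B.comp x (G ∪ ⁅ e ⁆) ρ)
    same e with lookup G e in e∉G
    ... | true  = refl
    ... | false = cong (sgn (countBelow G e) *_) (comp-via-blocks (G ∪ ⁅ e ⁆) (connected≡B e e∉G) x ρ)

-- σ a b c d e is the permutation of Fin 5 written in one-line notation.
σ : (a b c d e : Fin 5) → {True (inverts? (a ∷ b ∷ c ∷ d ∷ e ∷ []))} → Permutation′ 5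
σ a b c d e {v-inverts} = fromImages (a ∷ b ∷ c ∷ d ∷ e ∷ []) {v-inverts}

open ChainComplex K5edges using (ZG; Chain; connected; d; comp)
open Chains K5edges using (generator; chainOf; pairChain)
open DecMembership (_≟ₛ_ {10}) using (_∈?_)
open DecUnique (_≟ₛ_ {10}) using (unique?)

-- `connected` is an exponential path search, whereas component labels are cheap to evaluate;
-- the two agree on every subset of at most two edges (labels-agree₀,₁,₂).
module ByLabels = Boundary K5edges (sameLabel K5edges)

x : Chain
x = chainOf
  ( (⁅ 0F ⁆ ,
       (- + 1 , σ 0F 1F 2F 3F 4F) ∷ (- + 1 , σ 0F 1F 2F 4F 3F) ∷ (- + 1 , σ 0F 1F 3F 2F 4F) ∷
       (- + 1 , σ 0F 1F 3F 4F 2F) ∷ (- + 1 , σ 0F 2F 3F 1F 4F) ∷ (- + 1 , σ 0F 2F 3F 4F 1F) ∷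
       (- + 1 , σ 0F 3F 2F 1F 4F) ∷ (- + 1 , σ 0F 3F 2F 4F 1F) ∷ (- + 1 , σ 1F 2F 0F 3F 4F) ∷
       (- + 1 , σ 1F 2F 0F 4F 3F) ∷ (- + 2 , σ 1F 2F 3F 0F 4F) ∷ (- + 1 , σ 1F 2F 3F 4F 0F) ∷
       (- + 1 , σ 1F 2F 4F 3F 0F) ∷ (- + 1 , σ 1F 3F 0F 2F 4F) ∷ (- + 1 , σ 1F 3F 0F 4F 2F) ∷
       (- + 2 , σ 1F 3F 2F 0F 4F) ∷ (- + 1 , σ 1F 3F 2F 4F 0F) ∷ (- + 1 , σ 1F 3F 4F 2F 0F) ∷
       (- + 1 , σ 1F 4F 2F 0F 3F) ∷ (- + 1 , σ 1F 4F 2F 3F 0F) ∷ (- + 1 , σ 1F 4F 3F 0F 2F) ∷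
       (- + 1 , σ 1F 4F 3F 2F 0F) ∷ (- + 1 , σ 2F 3F 0F 1F 4F) ∷ (- + 2 , σ 2F 3F 0F 4F 1F) ∷
       (- + 1 , σ 2F 3F 1F 0F 4F) ∷ (- + 1 , σ 2F 3F 1F 4F 0F) ∷ (- + 1 , σ 2F 3F 4F 0F 1F) ∷
       (- + 1 , σ 2F 3F 4F 1F 0F) ∷ (- + 1 , σ 2F 4F 1F 3F 0F) ∷ (- + 1 , σ 2F 4F 3F 0F 1F) ∷
       (- + 1 , σ 2F 4F 3F 1F 0F) ∷ (- + 1 , σ 3F 4F 1F 2F 0F) ∷ (- + 1 , σ 3F 4F 2F 0F 1F) ∷
       (- + 1 , σ 3F 4F 2F 1F 0F) ∷ [])
  ∷ (⁅ 1F ⁆ ,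
       (- + 1 , σ 0F 1F 2F 3F 4F) ∷ (- + 1 , σ 0F 1F 2F 4F 3F) ∷ (- + 1 , σ 0F 1F 3F 2F 4F) ∷
       (- + 1 , σ 0F 1F 3F 4F 2F) ∷ (- + 1 , σ 0F 2F 1F 4F 3F) ∷ (- + 1 , σ 0F 3F 1F 4F 2F) ∷
       (- + 1 , σ 1F 2F 4F 0F 3F) ∷ (- + 1 , σ 1F 3F 4F 0F 2F) ∷ [])
  ∷ (⁅ 2F ⁆ ,
       (- + 1 , σ 0F 1F 2F 4F 3F) ∷ (- + 1 , σ 0F 1F 3F 4F 2F) ∷ (- + 1 , σ 0F 2F 1F 3F 4F) ∷
       (- + 1 , σ 0F 2F 1F 4F 3F) ∷ (- + 1 , σ 0F 3F 1F 2F 4F) ∷ (- + 1 , σ 0F 3F 1F 4F 2F) ∷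
       (+ 1 , σ 2F 1F 0F 3F 4F) ∷ [])
  ∷ (⁅ 3F ⁆ ,
       (+ 1 , σ 0F 1F 2F 4F 3F) ∷ (+ 1 , σ 0F 1F 3F 4F 2F) ∷ (+ 1 , σ 0F 2F 1F 4F 3F) ∷
       (+ 1 , σ 0F 3F 1F 4F 2F) ∷ (- + 1 , σ 1F 0F 2F 4F 3F) ∷ (- + 1 , σ 1F 0F 3F 4F 2F) ∷
       (+ 1 , σ 1F 2F 3F 0F 4F) ∷ (+ 1 , σ 1F 3F 2F 0F 4F) ∷ (+ 1 , σ 2F 1F 0F 4F 3F) ∷
       (+ 1 , σ 2F 1F 3F 0F 4F) ∷ (+ 1 , σ 2F 3F 1F 0F 4F) ∷ (+ 1 , σ 3F 1F 2F 0F 4F) ∷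
       (+ 1 , σ 3F 2F 1F 0F 4F) ∷ [])
  ∷ (⁅ 4F ⁆ ,
       (+ 1 , σ 0F 1F 2F 3F 4F) ∷ (+ 1 , σ 0F 1F 3F 2F 4F) ∷ (+ 1 , σ 0F 2F 3F 1F 4F) ∷
       (+ 1 , σ 0F 2F 3F 4F 1F) ∷ (+ 1 , σ 1F 2F 3F 0F 4F) ∷ (+ 1 , σ 1F 2F 3F 4F 0F) ∷
       (+ 1 , σ 1F 2F 4F 3F 0F) ∷ (+ 1 , σ 1F 3F 4F 2F 0F) ∷ (+ 1 , σ 2F 0F 3F 1F 4F) ∷
       (+ 1 , σ 2F 0F 3F 4F 1F) ∷ (+ 1 , σ 2F 1F 3F 0F 4F) ∷ (+ 1 , σ 2F 1F 4F 3F 0F) ∷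
       (+ 1 , σ 2F 3F 4F 1F 0F) ∷ (+ 1 , σ 3F 0F 2F 1F 4F) ∷ (+ 1 , σ 3F 0F 2F 4F 1F) ∷
       (+ 1 , σ 3F 1F 2F 0F 4F) ∷ (+ 1 , σ 3F 1F 4F 2F 0F) ∷ (+ 1 , σ 3F 2F 4F 1F 0F) ∷
       (+ 1 , σ 4F 1F 2F 3F 0F) ∷ (+ 1 , σ 4F 1F 3F 2F 0F) ∷ (+ 1 , σ 4F 2F 3F 1F 0F) ∷ [])
  ∷ (⁅ 5F ⁆ ,
       (+ 1 , σ 2F 0F 3F 4F 1F) ∷ (+ 1 , σ 3F 0F 2F 4F 1F) ∷ [])
  ∷ (⁅ 6F ⁆ ,
       (+ 1 , σ 0F 2F 1F 4F 3F) ∷ (+ 1 , σ 4F 2F 1F 0F 3F) ∷ [])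
  ∷ (⁅ 7F ⁆ ,
       (+ 1 , σ 1F 2F 0F 4F 3F) ∷ (+ 1 , σ 1F 3F 0F 4F 2F) ∷ (+ 1 , σ 2F 3F 0F 4F 1F) ∷
       (+ 1 , σ 3F 2F 0F 4F 1F) ∷ [])
  ∷ (⁅ 8F ⁆ ,
       (+ 1 , σ 0F 1F 2F 4F 3F) ∷ (+ 1 , σ 1F 0F 2F 4F 3F) ∷ (+ 1 , σ 1F 4F 2F 0F 3F) ∷
       (+ 1 , σ 4F 1F 2F 0F 3F) ∷ [])
  ∷ (⁅ 9F ⁆ ,
       (+ 1 , σ 0F 1F 2F 3F 4F) ∷ (+ 1 , σ 0F 1F 3F 2F 4F) ∷ (+ 1 , σ 1F 0F 2F 3F 4F) ∷
       (+ 1 , σ 1F 0F 3F 2F 4F) ∷ (+ 1 , σ 1F 2F 0F 3F 4F) ∷ (+ 1 , σ 1F 3F 0F 2F 4F) ∷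
       (+ 1 , σ 2F 1F 0F 3F 4F) ∷ (+ 1 , σ 3F 1F 0F 2F 4F) ∷ [])
  ∷ [] )

y : List ((Fin 10 × Fin 10) × ZG)
y =
  ( ((0F , 1F) ,
       (+ 1 , σ 0F 2F 3F 4F 1F) ∷ (+ 1 , σ 1F 2F 3F 0F 4F) ∷ (+ 1 , σ 1F 2F 3F 4F 0F) ∷
       (+ 1 , σ 2F 3F 4F 0F 1F) ∷ [])
  ∷ ((0F , 2F) ,
       (+ 1 , σ 0F 1F 2F 3F 4F) ∷ (+ 1 , σ 0F 1F 3F 2F 4F) ∷ (+ 1 , σ 1F 2F 0F 3F 4F) ∷
       (+ 1 , σ 1F 2F 3F 4F 0F) ∷ (+ 1 , σ 1F 2F 4F 3F 0F) ∷ (+ 1 , σ 1F 3F 2F 4F 0F) ∷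
       (+ 1 , σ 2F 3F 1F 4F 0F) ∷ [])
  ∷ ((0F , 3F) ,
       (+ 1 , σ 1F 2F 0F 4F 3F) ∷ (+ 1 , σ 1F 2F 3F 0F 4F) ∷ (+ 1 , σ 1F 3F 2F 0F 4F) ∷ [])
  ∷ ((0F , 4F) ,
       (+ 1 , σ 0F 2F 3F 1F 4F) ∷ (+ 1 , σ 0F 2F 3F 4F 1F) ∷ (+ 1 , σ 1F 2F 3F 0F 4F) ∷
       (+ 1 , σ 1F 2F 4F 3F 0F) ∷ (+ 1 , σ 1F 3F 4F 2F 0F) ∷ (+ 1 , σ 2F 3F 4F 1F 0F) ∷ [])
  ∷ ((0F , 7F) ,
       (+ 1 , σ 2F 3F 0F 4F 1F) ∷ [])
  ∷ ((0F , 8F) ,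
       (+ 1 , σ 0F 1F 2F 4F 3F) ∷ (+ 1 , σ 1F 4F 2F 0F 3F) ∷ [])
  ∷ ((0F , 9F) ,
       (+ 1 , σ 0F 1F 2F 3F 4F) ∷ (+ 1 , σ 0F 1F 3F 2F 4F) ∷ (+ 1 , σ 1F 2F 0F 3F 4F) ∷
       (+ 1 , σ 1F 3F 0F 2F 4F) ∷ [])
  ∷ ((1F , 2F) ,
       (+ 1 , σ 0F 1F 2F 3F 4F) ∷ [])
  ∷ ((1F , 3F) ,
       (+ 1 , σ 0F 1F 2F 4F 3F) ∷ (+ 1 , σ 0F 2F 1F 4F 3F) ∷ (+ 1 , σ 0F 3F 1F 4F 2F) ∷
       (+ 1 , σ 1F 2F 3F 0F 4F) ∷ (+ 1 , σ 1F 3F 2F 0F 4F) ∷ [])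
  ∷ ((1F , 5F) ,
       (+ 1 , σ 2F 0F 3F 4F 1F) ∷ [])
  ∷ ((1F , 6F) ,
       (+ 1 , σ 0F 2F 1F 4F 3F) ∷ (+ 1 , σ 1F 2F 4F 0F 3F) ∷ [])
  ∷ ((1F , 9F) ,
       (+ 1 , σ 0F 1F 2F 3F 4F) ∷ (+ 1 , σ 0F 1F 3F 2F 4F) ∷ [])
  ∷ ((2F , 3F) ,
       (+ 1 , σ 0F 1F 2F 3F 4F) ∷ (+ 1 , σ 0F 1F 3F 2F 4F) ∷ (+ 1 , σ 0F 2F 1F 3F 4F) ∷
       (+ 1 , σ 0F 3F 1F 2F 4F) ∷ [])
  ∷ ((2F , 4F) ,
       (+ 1 , σ 0F 1F 2F 3F 4F) ∷ (+ 1 , σ 0F 1F 3F 2F 4F) ∷ (+ 1 , σ 0F 2F 3F 1F 4F) ∷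
       (+ 1 , σ 1F 0F 2F 3F 4F) ∷ (+ 1 , σ 1F 0F 3F 2F 4F) ∷ (+ 1 , σ 1F 2F 3F 4F 0F) ∷
       (+ 1 , σ 1F 2F 4F 3F 0F) ∷ (+ 1 , σ 1F 3F 4F 2F 0F) ∷ (+ 1 , σ 2F 1F 4F 3F 0F) ∷ [])
  ∷ ((2F , 6F) ,
       (+ 1 , σ 0F 2F 1F 4F 3F) ∷ [])
  ∷ ((2F , 8F) ,
       (+ 1 , σ 0F 1F 2F 4F 3F) ∷ [])
  ∷ ((3F , 4F) ,
       (+ 1 , σ 0F 1F 2F 3F 4F) ∷ (+ 1 , σ 0F 1F 3F 2F 4F) ∷ (+ 1 , σ 0F 2F 3F 4F 1F) ∷
       (+ 1 , σ 1F 0F 2F 4F 3F) ∷ (+ 1 , σ 1F 0F 3F 4F 2F) ∷ [])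
  ∷ ((3F , 5F) ,
       (+ 1 , σ 1F 0F 2F 4F 3F) ∷ (+ 1 , σ 1F 0F 3F 4F 2F) ∷ [])
  ∷ ((3F , 7F) ,
       (+ 1 , σ 1F 2F 0F 4F 3F) ∷ (+ 1 , σ 1F 3F 0F 4F 2F) ∷ [])
  ∷ ((4F , 9F) ,
       (+ 1 , σ 1F 0F 2F 3F 4F) ∷ (+ 1 , σ 1F 0F 3F 2F 4F) ∷ [])
  ∷ ((5F , 8F) ,
       (+ 1 , σ 1F 0F 2F 4F 3F) ∷ [])
  ∷ ((6F , 7F) ,
       (+ 1 , σ 1F 2F 0F 4F 3F) ∷ [])
  ∷ [] )

-- Summing the ⁅ i ⁆-coefficients at these permutations is a cocycle modulo 2 that is odd on x.
cocycleGroups : List (Fin 10 × List (Permutation′ 5))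
cocycleGroups =
  ( (1F ,
       σ 0F 3F 1F 2F 4F ∷ σ 0F 3F 1F 4F 2F ∷ σ 0F 3F 2F 1F 4F ∷ σ 0F 3F 2F 4F 1F ∷
       σ 0F 3F 4F 1F 2F ∷ σ 0F 3F 4F 2F 1F ∷ σ 1F 0F 3F 2F 4F ∷ σ 1F 0F 3F 4F 2F ∷
       σ 2F 0F 3F 1F 4F ∷ σ 2F 0F 3F 4F 1F ∷ σ 3F 0F 4F 1F 2F ∷ σ 3F 0F 4F 2F 1F ∷ [])
  ∷ (3F ,
       σ 0F 1F 2F 3F 4F ∷ σ 0F 1F 4F 3F 2F ∷ σ 0F 2F 1F 3F 4F ∷ σ 0F 2F 4F 3F 1F ∷
       σ 0F 4F 1F 3F 2F ∷ σ 0F 4F 2F 3F 1F ∷ σ 1F 2F 4F 0F 3F ∷ σ 1F 4F 2F 0F 3F ∷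
       σ 2F 1F 4F 0F 3F ∷ σ 2F 4F 1F 0F 3F ∷ σ 3F 1F 2F 0F 4F ∷ σ 3F 2F 1F 0F 4F ∷ [])
  ∷ (5F ,
       σ 0F 1F 2F 3F 4F ∷ σ 0F 1F 4F 3F 2F ∷ σ 0F 2F 1F 3F 4F ∷ σ 0F 2F 4F 3F 1F ∷
       σ 0F 3F 1F 4F 2F ∷ σ 0F 3F 2F 4F 1F ∷ σ 3F 0F 1F 2F 4F ∷ σ 3F 0F 1F 4F 2F ∷
       σ 3F 0F 2F 1F 4F ∷ σ 3F 0F 2F 4F 1F ∷ σ 3F 0F 4F 1F 2F ∷ σ 3F 0F 4F 2F 1F ∷ [])
  ∷ (6F ,
       σ 1F 0F 3F 2F 4F ∷ σ 1F 0F 3F 4F 2F ∷ σ 1F 2F 0F 4F 3F ∷ σ 1F 3F 0F 2F 4F ∷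
       σ 2F 0F 3F 1F 4F ∷ σ 2F 0F 3F 4F 1F ∷ σ 2F 1F 0F 4F 3F ∷ σ 2F 3F 0F 1F 4F ∷
       σ 4F 0F 3F 1F 2F ∷ σ 4F 0F 3F 2F 1F ∷ σ 4F 1F 0F 2F 3F ∷ σ 4F 2F 0F 1F 3F ∷ [])
  ∷ (7F ,
       σ 1F 2F 0F 4F 3F ∷ σ 1F 2F 3F 4F 0F ∷ σ 1F 4F 0F 2F 3F ∷ σ 1F 4F 2F 3F 0F ∷
       σ 2F 1F 0F 4F 3F ∷ σ 2F 1F 3F 4F 0F ∷ σ 2F 4F 0F 1F 3F ∷ σ 2F 4F 1F 3F 0F ∷
       σ 4F 1F 0F 2F 3F ∷ σ 4F 1F 2F 3F 0F ∷ σ 4F 2F 0F 1F 3F ∷ σ 4F 2F 1F 3F 0F ∷ [])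
  ∷ [] )

cocycle : List (Fin 10 × Permutation′ 5)
cocycle = concatMap (λ { (i , ρs) → map (i ,_) ρs }) cocycleGroups

edgePairs : List (Fin 10 × Fin 10)
edgePairs = filter (λ pq → proj₁ pq <? proj₂ pq) (cartesianProduct (allFin 10) (allFin 10))

labels-complete₀ : ∀ e u v → T (sameLabel K5edges (⊥ ∪ ⁅ e ⁆) u v) → T (connected (⊥ ∪ ⁅ e ⁆) u v)
labels-complete₀ = from-yes (all? λ e → all? λ u → all? λ v →
  T? (sameLabel K5edges (⊥ ∪ ⁅ e ⁆) u v) →-dec T? (connected (⊥ ∪ ⁅ e ⁆) u v))

labels-complete₁ : ∀ i u v → T (sameLabel K5edges ⁅ i ⁆ u v) → T (connected ⁅ i ⁆ u v)
labels-complete₁ = from-yes (all? λ i → all? λ u → all? λ v →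
  T? (sameLabel K5edges ⁅ i ⁆ u v) →-dec T? (connected ⁅ i ⁆ u v))

labels-complete₂ : ∀ i e u v → T (sameLabel K5edges (⁅ i ⁆ ∪ ⁅ e ⁆) u v) → T (connected (⁅ i ⁆ ∪ ⁅ e ⁆) u v)
labels-complete₂ = from-yes (all? λ i → all? λ e → all? λ u → all? λ v →
  T? (sameLabel K5edges (⁅ i ⁆ ∪ ⁅ e ⁆) u v) →-dec T? (connected (⁅ i ⁆ ∪ ⁅ e ⁆) u v))

x-cycle-at-unrank : ∀ k → ByLabels.d x ⊥ (unrank 5 k) ≡ + 0
x-cycle-at-unrank = from-yes (all? λ k → ByLabels.d x ⊥ (unrank 5 k) ℤ.≟ + 0)

y-pairs-distinct : All (λ { ((p , q) , _) → p ≢ q }) y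
y-pairs-distinct = from-yes (All.all? (λ { ((p , q) , _) → ¬? (p ≟ q) }) y)

∂y-at-unrank : ∀ i k → ByLabels.pairChainBoundary y i (unrank 5 k) ≡ + 2 * ByLabels.comp x ⁅ i ⁆ (unrank 5 k)
∂y-at-unrank = from-yes (all? λ i → all? λ k →
  ByLabels.pairChainBoundary y i (unrank 5 k) ℤ.≟ + 2 * ByLabels.comp x ⁅ i ⁆ (unrank 5 k))

cocycle-x : sumOver cocycle (ByLabels.comp x) ≡ + 3
cocycle-x = refl

edgePairs-distinct : All (λ { (p , q) → p ≢ q }) edgePairs
edgePairs-distinct = from-yes (All.all? (λ { (p , q) → ¬? (p ≟ q) }) edgePairs)

generators-even-at-unrank : All (λ pq → ∀ k → + 2 ∣ ByLabels.generatorSum cocycle pq (unrank 5 k)) edgePairs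
generators-even-at-unrank = from-yes (All.all? (λ pq → all? λ k → + 2 ∣? ByLabels.generatorSum cocycle pq (unrank 5 k)) edgePairs)

pairSubsets-unique : Unique (map pairSubset edgePairs)
pairSubsets-unique = from-yes (unique? (map pairSubset edgePairs))

faces∈pairSubsets : ∀ i e → lookup ⁅ i ⁆ e ≡ false → ⁅ i ⁆ ∪ ⁅ e ⁆ ∈ map pairSubset edgePairs
faces∈pairSubsets = from-yes (all? λ i → all? λ e →
  (lookup ⁅ i ⁆ e Bool.≟ false) →-dec (⁅ i ⁆ ∪ ⁅ e ⁆ ∈? map pairSubset edgePairs))

labels-agree₀ : ∀ e → lookup ⊥ e ≡ false → ∀ u v → connected (⊥ ∪ ⁅ e ⁆) u v ≡ sameLabel K5edges (⊥ ∪ ⁅ e ⁆) u v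
labels-agree₀ e _ = connected≡sameLabel K5edges (⊥ ∪ ⁅ e ⁆) (labels-complete₀ e)

labels-agree₁ : ∀ i u v → connected ⁅ i ⁆ u v ≡ sameLabel K5edges ⁅ i ⁆ u v
labels-agree₁ i = connected≡sameLabel K5edges ⁅ i ⁆ (labels-complete₁ i)

labels-agree₂ : ∀ i e → lookup ⁅ i ⁆ e ≡ false → ∀ u v → connected (⁅ i ⁆ ∪ ⁅ e ⁆) u v ≡ sameLabel K5edges (⁅ i ⁆ ∪ ⁅ e ⁆) u v
labels-agree₂ i e _ = connected≡sameLabel K5edges (⁅ i ⁆ ∪ ⁅ e ⁆) (labels-complete₂ i e)

d≡byLabels : ∀ z i ρ → d z ⁅ i ⁆ ρ ≡ ByLabels.d z ⁅ i ⁆ ρ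
d≡byLabels z i ρ = d-via-blocks K5edges {sameLabel K5edges} ⁅ i ⁆ (labels-agree₂ i) z ρ

comp≡byLabels : ∀ z i ρ → comp z ⁅ i ⁆ ρ ≡ ByLabels.comp z ⁅ i ⁆ ρ
comp≡byLabels z i ρ = comp-via-blocks K5edges {sameLabel K5edges} ⁅ i ⁆ (labels-agree₁ i) z ρ

x-is-cycle : ∀ G → ∣ G ∣ ≡ 0 → ∀ ρ → d x G ρ ≡ + 0
x-is-cycle G ∣G∣≡0 ρ = subst (λ G → d x G ρ ≡ + 0) (sym (∣p∣≡0⇒p≡⊥ G ∣G∣≡0)) (begin
  d x ⊥ ρ           ≡⟨ d-via-blocks K5edges {sameLabel K5edges} ⊥ labels-agree₀ x ρ ⟩
  ByLabels.d x ⊥ ρ  ≡⟨ ∀-by-unrank (λ π → ByLabels.d x ⊥ π ≡ + 0) resp x-cycle-at-unrank ρ ⟩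
  + 0               ∎)
  where
  open ≡-Reasoning
  resp : ∀ π π′ → π ≈ π′ → ByLabels.d x ⊥ π ≡ + 0 → ByLabels.d x ⊥ π′ ≡ + 0
  resp π π′ π≈π′ = trans (sym (ByLabels.d-≈ x ⊥ π π′ π≈π′))

2x-is-boundary-at : ∀ i ρ → d (pairChain y) ⁅ i ⁆ ρ ≡ + 2 * comp x ⁅ i ⁆ ρ
2x-is-boundary-at i ρ = begin
  d (pairChain y) ⁅ i ⁆ ρ           ≡⟨ d≡byLabels (pairChain y) i ρ ⟩
  ByLabels.d (pairChain y) ⁅ i ⁆ ρ  ≡⟨ ∀-by-unrank P resp P-unrank ρ ⟩
  + 2 * ByLabels.comp x ⁅ i ⁆ ρ     ≡⟨ cong (+ 2 *_) (sym (comp≡byLabels x i ρ)) ⟩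
  + 2 * comp x ⁅ i ⁆ ρ              ∎
  where
  open ≡-Reasoning
  P : Permutation′ 5 → Set
  P π = ByLabels.d (pairChain y) ⁅ i ⁆ π ≡ + 2 * ByLabels.comp x ⁅ i ⁆ π
  resp : ∀ π π′ → π ≈ π′ → P π → P π′
  resp π π′ π≈π′ Pπ = trans (sym (ByLabels.d-≈ (pairChain y) ⁅ i ⁆ π π′ π≈π′))
                            (trans Pπ (cong (+ 2 *_) (ByLabels.comp-≈ x ⁅ i ⁆ π π′ π≈π′)))
  P-unrank : ∀ k → P (unrank 5 k)
  P-unrank k = trans (ByLabels.d-pairChain y y-pairs-distinct i (unrank 5 k)) (∂y-at-unrank i k)

2x-is-boundary : ∀ F → ∣ F ∣ ≡ 1 → ∀ ρ → d (pairChain y) F ρ ≡ + 2 * comp x F ρ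
2x-is-boundary F ∣F∣≡1 ρ =
  subst (λ F → d (pairChain y) F ρ ≡ + 2 * comp x F ρ) (sym (proj₂ F≡⁅i⁆)) (2x-is-boundary-at (proj₁ F≡⁅i⁆) ρ)
  where
  F≡⁅i⁆ : ∃ λ i → F ≡ ⁅ i ⁆
  F≡⁅i⁆ = ∣p∣≡1⇒p≡⁅x⁆ F ∣F∣≡1

generator-even : ∀ {pq} → pq ∈ edgePairs → ∀ σ′ → + 2 ∣ sumOver cocycle (ByLabels.d (generator (pairSubset pq) σ′))
generator-even {pq} pq∈ σ′ =
  subst (+ 2 ∣_) (sym (ByLabels.sumOver-generator cocycle {pq} (All.lookup edgePairs-distinct pq∈) σ′))
    (∀-by-unrank (λ π → + 2 ∣ ByLabels.generatorSum cocycle pq π)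
                 (λ π π′ π≈π′ → subst (+ 2 ∣_) (ByLabels.generatorSum-≈ cocycle pq π π′ π≈π′))
                 (All.lookup generators-even-at-unrank pq∈) σ′)

generators-even : ∀ {K} → K ∈ map pairSubset edgePairs → ∀ σ′ → + 2 ∣ sumOver cocycle (ByLabels.d (generator K σ′))
generators-even {K} K∈ σ′ =
  subst (λ K → + 2 ∣ sumOver cocycle (ByLabels.d (generator K σ′))) (sym (proj₂ (proj₂ pq))) (generator-even (proj₁ (proj₂ pq)) σ′)
  where
  pq : ∃ λ pq → pq ∈ edgePairs × K ≡ pairSubset pq
  pq = ∈-map⁻ pairSubset K∈

x-is-not-boundary : ¬ (Σ Chain λ z → ∀ F → ∣ F ∣ ≡ 1 → ∀ ρ → d z F ρ ≡ comp x F ρ)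
x-is-not-boundary (z , ∂z≡x) = from-no (+ 2 ∣? + 3) (subst (+ 2 ∣_) cocycle-∂z
  (ByLabels.boundaries-divisible (+ 2) cocycle (map pairSubset edgePairs) pairSubsets-unique faces∈pairSubsets generators-even z))
  where
  cocycle-∂z : sumOver cocycle (ByLabels.d z) ≡ + 3
  cocycle-∂z = trans (sumOver-cong cocycle (ByLabels.d z) (ByLabels.comp x) λ i ρ →
                        trans (sym (d≡byLabels z i ρ)) (trans (∂z≡x ⁅ i ⁆ (∣⁅x⁆∣≡1 i) ρ) (comp≡byLabels x i ρ)))
                     cocycle-x

theorem4p1 : ChainComplex.H₁HasElementOfOrder2 K5edges
theorem4p1 = x , x-is-cycle , x-is-not-boundary , (pairChain y , 2x-is-boundary)
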